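{- Let $A$ be an MV-monoidal algebra and let $\theta$ be a lattice congruence on $\langle A;\vee,\wedge\rangle$ with $|A/\theta|=2$. Let $\theta^*=\{(a,b)\in A\times A\mid \text{for all }x\in A,\ (a\oplus x,b\oplus x)\in\theta\text{ and }(a\odot x,b\odot x)\in\theta\}$. Then $\theta^*$ is the greatest MVM-congruence on $A$ contained in $\theta$.
   Context: An MV-monoidal algebra is an algebra $\langle A;\oplus,\odot,\vee,\wedge,0,1\rangle$ satisfying: $\langle A;\vee,\wedge\rangle$ is a distributive lattice; $\langle A;\oplus,0\rangle$ and $\langle A;\odot,1\rangle$ are commutative monoids; $\oplus$ and $\odot$ both distribute over both $\vee$ and $\wedge$; $(x\oplus y)\odot((x\odot y)\oplus z)=(x\odot(y\oplus z))\oplus(y\odot z)$; $(x\odot y)\oplus((x\oplus y)\odot z)=(x\oplus(y\odot z))\odot(y\oplus z)$; $(x\odot y)\oplus z=((x\oplus y)\odot((x\odot y)\oplus z))\vee z$; $(x\oplus y)\odot z=((x\odot y)\oplus((x\oplus y)\odot z))\wedge z$. An MVM-congruence on $A$ is an equivalence relation on $A$ compatible with $\oplus,\odot,\vee,\wedge,0,1$ (i.e. a congruence of the algebra $A$). -}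

module Defs where

open import Level using (Level; _⊔_; suc)
open import Data.Product using (_×_; Σ; _,_)
open import Data.Sum using (_⊎_)
open import Relation.Nullary using (¬_)
open import Relation.Binary.Core using (Rel; _⇒_)
open import Relation.Binary.Structures using (IsEquivalence)
open import Relation.Binary.PropositionalEquality using (_≡_)
open import Algebra.Core using (Op₂)
open import Algebra.Structures using (IsCommutativeMonoid)
open import Algebra.Lattice.Structures using (IsDistributiveLattice)
import Algebra.Definitions as D

record MVMonoidalAlgebra (a : Level) : Set (suc a) where
  infixl 7 _⊙_
  infixl 6 _⊕_
  infixl 5 _∨_
  infixl 5 _∧_
  field
    Carrier : Set a
    _⊕_ _⊙_ _∨_ _∧_ : Op₂ Carrier
    𝟎 𝟏 : Carrier
    isDistributiveLattice : IsDistributiveLattice _≡_ _∨_ _∧_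
    ⊕-isCommutativeMonoid : IsCommutativeMonoid _≡_ _⊕_ 𝟎
    ⊙-isCommutativeMonoid : IsCommutativeMonoid _≡_ _⊙_ 𝟏
    ⊕-distrib-∨ : D._DistributesOver_ _≡_ _⊕_ _∨_
    ⊕-distrib-∧ : D._DistributesOver_ _≡_ _⊕_ _∧_
    ⊙-distrib-∨ : D._DistributesOver_ _≡_ _⊙_ _∨_
    ⊙-distrib-∧ : D._DistributesOver_ _≡_ _⊙_ _∧_
    ax1 : ∀ x y z → (x ⊕ y) ⊙ ((x ⊙ y) ⊕ z) ≡ (x ⊙ (y ⊕ z)) ⊕ (y ⊙ z)
    ax2 : ∀ x y z → (x ⊙ y) ⊕ ((x ⊕ y) ⊙ z) ≡ (x ⊕ (y ⊙ z)) ⊙ (y ⊕ z)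
    ax3 : ∀ x y z → (x ⊙ y) ⊕ z ≡ ((x ⊕ y) ⊙ ((x ⊙ y) ⊕ z)) ∨ z
    ax4 : ∀ x y z → (x ⊕ y) ⊙ z ≡ ((x ⊙ y) ⊕ ((x ⊕ y) ⊙ z)) ∧ z

module _ {a : Level} (M : MVMonoidalAlgebra a) where
  open MVMonoidalAlgebra M

  record IsLatticeCongruence {ℓ : Level} (θ : Rel Carrier ℓ) : Set (a ⊔ ℓ) where
    field
      isEquivalence : IsEquivalence θ
      ∨-cong : D.Congruent₂ θ _∨_
      ∧-cong : D.Congruent₂ θ _∧_

  -- An MVM-congruence: a congruence of the full algebra (compatibility with the
  -- constants 0, 1 is automatic by reflexivity).
  record IsMVMCongruence {ℓ : Level} (θ : Rel Carrier ℓ) : Set (a ⊔ ℓ) where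
    field
      isEquivalence : IsEquivalence θ
      ⊕-cong : D.Congruent₂ θ _⊕_
      ⊙-cong : D.Congruent₂ θ _⊙_
      ∨-cong : D.Congruent₂ θ _∨_
      ∧-cong : D.Congruent₂ θ _∧_

  HasExactlyTwoClasses : {ℓ : Level} → Rel Carrier ℓ → Set (a ⊔ ℓ)
  HasExactlyTwoClasses θ =
    Σ Carrier λ p → Σ Carrier λ q → ¬ θ p q × (∀ x → θ x p ⊎ θ x q)

  star : {ℓ : Level} → Rel Carrier ℓ → Rel Carrier (a ⊔ ℓ)
  star θ u v = ∀ x → θ (u ⊕ x) (v ⊕ x) × θ (u ⊙ x) (v ⊙ x)

  IsGreatestMVMCongruenceIn : {ℓ ℓψ : Level} (ℓ' : Level) →
    Rel Carrier ℓψ → Rel Carrier ℓ → Set (a ⊔ ℓ ⊔ ℓψ ⊔ suc ℓ')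
  IsGreatestMVMCongruenceIn ℓ' ψ θ =
    IsMVMCongruence ψ × (ψ ⇒ θ) ×
    (∀ (φ : Rel Carrier ℓ') → IsMVMCongruence φ → φ ⇒ θ → φ ⇒ ψ)

-- A lattice congruence θ with two classes is the kernel of a lattice homomorphism
-- h onto the two-element lattice. θ* is closed under ∨ and ∧ for any lattice
-- congruence, and it is closed under ⊕ c because h ((a ⊕ c) ⊙ x) is determined by
-- values that θ* controls, namely h x, h a, h (a ⊙ (c ⊕ x)) and h (a ⊕ c ⊙ x).
-- This is where the MV-monoidal axioms enter: with p = a ⊙ c ⊕ (a ⊕ c) ⊙ x they
-- give (a ⊕ c) ⊙ x = p ∧ x, a ⊕ c ⊙ x = p ∨ a and a ⊙ (c ⊕ x) ≤ p, which pin
-- h ((a ⊕ c) ⊙ x) down in every case. Closure under ⊙ c is the same statement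
-- for the dual algebra (⊕/⊙, ∨/∧, 0/1 swapped) and the homomorphism not ∘ h.
module Submission where

open import Defs
open import Level using (Level; _⊔_)
open import Function.Base using (_∘_; _on_)
open import Data.Bool.Base using (Bool; true; false; not; if_then_else_)
  renaming (_∧_ to _∧ᵇ_; _∨_ to _∨ᵇ_)
open import Data.Bool.Properties using (not-injective; ∨-∧-booleanAlgebra)
  renaming (∨-comm to ∨ᵇ-comm; ∧-zeroʳ to ∧ᵇ-zeroʳ; ∧-identityʳ to ∧ᵇ-identityʳ;
            ∨-identityʳ to ∨ᵇ-identityʳ)
open import Algebra.Lattice.Properties.BooleanAlgebra ∨-∧-booleanAlgebra
  using (deMorgan₁; deMorgan₂)
open import Algebra.Lattice.Bundles using (DistributiveLattice)
open import Algebra.Lattice.Structures using (IsDistributiveLattice)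
open import Algebra.Structures using (IsCommutativeMonoid)
import Algebra.Lattice.Properties.DistributiveLattice as DistributiveLatticeProperties
open import Data.Product.Base using (Σ; _,_; proj₁; proj₂)
  renaming (swap to ×-swap)
open import Data.Sum.Base using (_⊎_; inj₁; inj₂) renaming (swap to ⊎-swap)
open import Relation.Nullary using (¬_)
open import Data.Empty using (⊥-elim)
open import Relation.Binary.Core using (Rel; _⇒_)
open import Relation.Binary.Structures using (IsEquivalence)
open import Relation.Binary.PropositionalEquality
  using (_≡_; refl; sym; trans; cong; cong₂; subst; subst₂; module ≡-Reasoning)

distributiveLattice : ∀ {a} → MVMonoidalAlgebra a → DistributiveLattice a a
distributiveLattice M = record { isDistributiveLattice = MVMonoidalAlgebra.isDistributiveLattice M }

dual : ∀ {a} → MVMonoidalAlgebra a → MVMonoidalAlgebra a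
dual M = record
  { Carrier = Carrier
  ; _⊕_ = _⊙_
  ; _⊙_ = _⊕_
  ; _∨_ = _∧_
  ; _∧_ = _∨_
  ; 𝟎 = 𝟏
  ; 𝟏 = 𝟎
  ; isDistributiveLattice =
      DistributiveLatticeProperties.∧-∨-isDistributiveLattice (distributiveLattice M)
  ; ⊕-isCommutativeMonoid = ⊙-isCommutativeMonoid
  ; ⊙-isCommutativeMonoid = ⊕-isCommutativeMonoid
  ; ⊕-distrib-∨ = ⊙-distrib-∧
  ; ⊕-distrib-∧ = ⊙-distrib-∨
  ; ⊙-distrib-∨ = ⊕-distrib-∧
  ; ⊙-distrib-∧ = ⊕-distrib-∨
  ; ax1 = ax2
  ; ax2 = ax1
  ; ax3 = ax4
  ; ax4 = ax3
  }
  where open MVMonoidalAlgebra M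

module MVMonoidalAlgebraProperties {a} (M : MVMonoidalAlgebra a) where
  open MVMonoidalAlgebra M
  open IsDistributiveLattice isDistributiveLattice using (∨-comm; ∨-assoc)
  open DistributiveLatticeProperties (distributiveLattice M) using (∨-idem)
  open IsCommutativeMonoid ⊕-isCommutativeMonoid
    using () renaming (comm to ⊕-comm; identityʳ to ⊕-identityʳ)
  open IsCommutativeMonoid ⊙-isCommutativeMonoid
    using () renaming (comm to ⊙-comm; identityʳ to ⊙-identityʳ)
  open ≡-Reasoning

  infix 4 _≤_
  _≤_ : Rel Carrier a
  x ≤ y = x ∨ y ≡ y

  ∨-identityʳ : ∀ x → x ∨ 𝟎 ≡ x
  ∨-identityʳ x = begin
    x ∨ 𝟎        ≡⟨ cong (_∨ 𝟎) x≡s∨𝟎 ⟩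
    (s ∨ 𝟎) ∨ 𝟎  ≡⟨ ∨-assoc s 𝟎 𝟎 ⟩
    s ∨ (𝟎 ∨ 𝟎)  ≡⟨ cong (s ∨_) (∨-idem 𝟎) ⟩
    s ∨ 𝟎        ≡⟨ sym x≡s∨𝟎 ⟩
    x            ∎
    where
    s : Carrier
    s = (x ⊕ 𝟏) ⊙ (x ⊙ 𝟏 ⊕ 𝟎)
    x≡s∨𝟎 : x ≡ s ∨ 𝟎
    x≡s∨𝟎 = trans (sym (trans (⊕-identityʳ (x ⊙ 𝟏)) (⊙-identityʳ x))) (ax3 x 𝟏 𝟎)

  ∨-identityˡ : ∀ x → 𝟎 ∨ x ≡ x
  ∨-identityˡ x = trans (∨-comm 𝟎 x) (∨-identityʳ x)

  x≤x⊕y : ∀ x y → x ≤ x ⊕ y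
  x≤x⊕y x y = begin
    x ∨ x ⊕ y        ≡⟨ cong (_∨ x ⊕ y) (sym (⊕-identityʳ x)) ⟩
    x ⊕ 𝟎 ∨ x ⊕ y    ≡⟨ sym (proj₁ ⊕-distrib-∨ x 𝟎 y) ⟩
    x ⊕ (𝟎 ∨ y)      ≡⟨ cong (x ⊕_) (∨-identityˡ y) ⟩
    x ⊕ y            ∎

  ⊙-monoˡ-≤ : ∀ z {x y} → x ≤ y → x ⊙ z ≤ y ⊙ z
  ⊙-monoˡ-≤ z {x} {y} x≤y = trans (sym (proj₂ ⊙-distrib-∨ z x y)) (cong (_⊙ z) x≤y)

  x⊙[y⊕z]≡[z⊕y]⊙x : ∀ x y z → x ⊙ (y ⊕ z) ≡ (z ⊕ y) ⊙ x
  x⊙[y⊕z]≡[z⊕y]⊙x x y z = trans (⊙-comm x (y ⊕ z)) (cong (_⊙ x) (⊕-comm y z))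

  pivot : Carrier → Carrier → Carrier → Carrier
  pivot a c x = a ⊙ c ⊕ (a ⊕ c) ⊙ x

  a⊕c⊙x≡pivot∨a : ∀ a c x → a ⊕ c ⊙ x ≡ pivot a c x ∨ a
  a⊕c⊙x≡pivot∨a a c x = begin
    a ⊕ c ⊙ x                          ≡⟨ trans (⊕-comm a (c ⊙ x)) (cong (_⊕ a) (⊙-comm c x)) ⟩
    x ⊙ c ⊕ a                          ≡⟨ ax3 x c a ⟩
    (x ⊕ c) ⊙ (x ⊙ c ⊕ a) ∨ a          ≡⟨ cong (_∨ a) (ax1 x c a) ⟩
    (x ⊙ (c ⊕ a) ⊕ c ⊙ a) ∨ a          ≡⟨ cong (_∨ a) (trans (⊕-comm _ (c ⊙ a))
                                                         (cong₂ _⊕_ (⊙-comm c a) (x⊙[y⊕z]≡[z⊕y]⊙x x c a))) ⟩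
    pivot a c x ∨ a                    ∎

  a⊙[c⊕x]≤pivot : ∀ a c x → a ⊙ (c ⊕ x) ≤ pivot a c x
  a⊙[c⊕x]≤pivot a c x =
    subst (a ⊙ (c ⊕ x) ≤_) (sym (ax2 a c x)) (⊙-monoˡ-≤ (c ⊕ x) (x≤x⊕y a (c ⊙ x)))

module _ {a} (M : MVMonoidalAlgebra a) where
  open MVMonoidalAlgebra M

  record IsKernelOfLatticeHomToBool {ℓ} (θ : Rel Carrier ℓ) (h : Carrier → Bool) : Set (a ⊔ ℓ) where
    field
      ∨-homo : ∀ x y → h (x ∨ y) ≡ h x ∨ᵇ h y
      ∧-homo : ∀ x y → h (x ∧ y) ≡ h x ∧ᵇ h y
      θ⇒≡ : θ ⇒ (_≡_ on h)
      ≡⇒θ : (_≡_ on h) ⇒ θ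

dual-isKernel : ∀ {a ℓ} {M : MVMonoidalAlgebra a} {θ : Rel (MVMonoidalAlgebra.Carrier M) ℓ} {h} →
                IsKernelOfLatticeHomToBool M θ h → IsKernelOfLatticeHomToBool (dual M) θ (not ∘ h)
dual-isKernel {h = h} ker = record
  { ∨-homo = λ x y → trans (cong not (∧-homo x y)) (deMorgan₁ (h x) (h y))
  ; ∧-homo = λ x y → trans (cong not (∨-homo x y)) (deMorgan₂ (h x) (h y))
  ; θ⇒≡ = cong not ∘ θ⇒≡
  ; ≡⇒θ = ≡⇒θ ∘ not-injective
  }
  where open IsKernelOfLatticeHomToBool ker

∨ᵇ-antisym : ∀ {p q} → p ∨ᵇ q ≡ q → q ∨ᵇ p ≡ p → p ≡ q
∨ᵇ-antisym {p} {q} p≤q q≤p = trans (sym q≤p) (trans (∨ᵇ-comm q p) p≤q)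

module LatticeHomToBool {a} (M : MVMonoidalAlgebra a) (h : MVMonoidalAlgebra.Carrier M → Bool)
  (∨-homo : ∀ x y → h (MVMonoidalAlgebra._∨_ M x y) ≡ h x ∨ᵇ h y)
  (∧-homo : ∀ x y → h (MVMonoidalAlgebra._∧_ M x y) ≡ h x ∧ᵇ h y) where
  open MVMonoidalAlgebra M
  open MVMonoidalAlgebraProperties M
  open ≡-Reasoning

  h-mono : ∀ {x y} → x ≤ y → h x ∨ᵇ h y ≡ h y
  h-mono {x} {y} x≤y = trans (sym (∨-homo x y)) (cong h x≤y)

  h-[a⊕c]⊙x-false : ∀ a c {x} → h x ≡ false → h ((a ⊕ c) ⊙ x) ≡ false
  h-[a⊕c]⊙x-false a c {x} hx = begin
    h ((a ⊕ c) ⊙ x)            ≡⟨ cong h (ax4 a c x) ⟩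
    h (pivot a c x ∧ x)        ≡⟨ ∧-homo (pivot a c x) x ⟩
    h (pivot a c x) ∧ᵇ h x     ≡⟨ cong (h (pivot a c x) ∧ᵇ_) hx ⟩
    h (pivot a c x) ∧ᵇ false   ≡⟨ ∧ᵇ-zeroʳ (h (pivot a c x)) ⟩
    false                      ∎

  h-[a⊕c]⊙x-true : ∀ a c {x} → h x ≡ true → h ((a ⊕ c) ⊙ x) ≡ h (pivot a c x)
  h-[a⊕c]⊙x-true a c {x} hx = begin
    h ((a ⊕ c) ⊙ x)            ≡⟨ cong h (ax4 a c x) ⟩
    h (pivot a c x ∧ x)        ≡⟨ ∧-homo (pivot a c x) x ⟩
    h (pivot a c x) ∧ᵇ h x     ≡⟨ cong (h (pivot a c x) ∧ᵇ_) hx ⟩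
    h (pivot a c x) ∧ᵇ true    ≡⟨ ∧ᵇ-identityʳ (h (pivot a c x)) ⟩
    h (pivot a c x)            ∎

  h-a⊕c⊙x-false : ∀ {a} c x → h a ≡ false → h (a ⊕ c ⊙ x) ≡ h (pivot a c x)
  h-a⊕c⊙x-false {a} c x ha = begin
    h (a ⊕ c ⊙ x)              ≡⟨ cong h (a⊕c⊙x≡pivot∨a a c x) ⟩
    h (pivot a c x ∨ a)        ≡⟨ ∨-homo (pivot a c x) a ⟩
    h (pivot a c x) ∨ᵇ h a     ≡⟨ cong (h (pivot a c x) ∨ᵇ_) ha ⟩
    h (pivot a c x) ∨ᵇ false   ≡⟨ ∨ᵇ-identityʳ (h (pivot a c x)) ⟩
    h (pivot a c x)            ∎

  h-a⊙[c⊕x]≤h-[a⊕c]⊙x : ∀ a c {x} → h x ≡ true →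
                        h (a ⊙ (c ⊕ x)) ∨ᵇ h ((a ⊕ c) ⊙ x) ≡ h ((a ⊕ c) ⊙ x)
  h-a⊙[c⊕x]≤h-[a⊕c]⊙x a c hx rewrite h-[a⊕c]⊙x-true a c hx = h-mono (a⊙[c⊕x]≤pivot a c _)

  h-[a⊕c]⊙x : ∀ a c x →
              h ((a ⊕ c) ⊙ x) ≡ h x ∧ᵇ (if h a then h (a ⊙ (c ⊕ x)) else h (a ⊕ c ⊙ x))
  h-[a⊕c]⊙x a c x with h x in hx | h a in ha
  ... | false | _ = h-[a⊕c]⊙x-false a c hx
  ... | true | false = trans (h-[a⊕c]⊙x-true a c hx) (sym (h-a⊕c⊙x-false c x ha))
  ... | true | true = ∨ᵇ-antisym
    -- the same bound with the roles of a and x exchanged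
    (subst₂ (λ u v → h u ∨ᵇ h v ≡ h v) (x⊙[y⊕z]≡[z⊕y]⊙x x c a) (sym (x⊙[y⊕z]≡[z⊕y]⊙x a c x))
      (h-a⊙[c⊕x]≤h-[a⊕c]⊙x x c ha))
    (h-a⊙[c⊕x]≤h-[a⊕c]⊙x a c hx)

module StarRelation {a ℓ} (M : MVMonoidalAlgebra a) (θ : Rel (MVMonoidalAlgebra.Carrier M) ℓ) where
  open MVMonoidalAlgebra M
  open IsCommutativeMonoid ⊕-isCommutativeMonoid
    using () renaming (comm to ⊕-comm; identityʳ to ⊕-identityʳ)
  open IsCommutativeMonoid ⊙-isCommutativeMonoid using () renaming (comm to ⊙-comm)

  θ* : Rel Carrier (a ⊔ ℓ)
  θ* = star M θ

  star⇒θ : θ* ⇒ θ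
  star⇒θ {u} {v} s = subst₂ θ (⊕-identityʳ u) (⊕-identityʳ v) (proj₁ (s 𝟎))

  ⇒star : ∀ {ℓ'} (φ : Rel Carrier ℓ') → IsMVMCongruence M φ → φ ⇒ θ → φ ⇒ θ*
  ⇒star φ φ-cong φ⇒θ u∼v x =
    φ⇒θ (⊕-cong u∼v (IsEquivalence.refl isEquivalence)) ,
    φ⇒θ (⊙-cong u∼v (IsEquivalence.refl isEquivalence))
    where open IsMVMCongruence φ-cong

  module _ (θ-cong : IsLatticeCongruence M θ) where
    open IsLatticeCongruence θ-cong
    open IsEquivalence isEquivalence
      using () renaming (refl to θ-refl; sym to θ-sym; trans to θ-trans)

    star-isEquivalence : IsEquivalence θ*
    star-isEquivalence = record
      { refl = λ x → θ-refl , θ-refl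
      ; sym = λ s x → θ-sym (proj₁ (s x)) , θ-sym (proj₂ (s x))
      ; trans = λ s r x → θ-trans (proj₁ (s x)) (proj₁ (r x)) , θ-trans (proj₂ (s x)) (proj₂ (r x))
      }

    congruent-from-right : ∀ (_∙_ : Carrier → Carrier → Carrier) → (∀ x y → x ∙ y ≡ y ∙ x) →
                           (∀ c {u v} → θ* u v → θ* (u ∙ c) (v ∙ c)) →
                           ∀ {u v x y} → θ* u v → θ* x y → θ* (u ∙ x) (v ∙ y)
    congruent-from-right _∙_ comm right {u} {v} {x} {y} u∼v x∼y =
      IsEquivalence.trans star-isEquivalence (right x u∼v)
        (subst₂ θ* (comm x v) (comm y v) (right v x∼y))

    star-∨-cong : ∀ {u v x y} → θ* u v → θ* x y → θ* (u ∨ x) (v ∨ y)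
    star-∨-cong {u} {v} {x} {y} u∼v x∼y z =
      subst₂ θ (sym (proj₂ ⊕-distrib-∨ z u x)) (sym (proj₂ ⊕-distrib-∨ z v y))
        (∨-cong (proj₁ (u∼v z)) (proj₁ (x∼y z))) ,
      subst₂ θ (sym (proj₂ ⊙-distrib-∨ z u x)) (sym (proj₂ ⊙-distrib-∨ z v y))
        (∨-cong (proj₂ (u∼v z)) (proj₂ (x∼y z)))

    star-∧-cong : ∀ {u v x y} → θ* u v → θ* x y → θ* (u ∧ x) (v ∧ y)
    star-∧-cong {u} {v} {x} {y} u∼v x∼y z =
      subst₂ θ (sym (proj₂ ⊕-distrib-∧ z u x)) (sym (proj₂ ⊕-distrib-∧ z v y))
        (∧-cong (proj₁ (u∼v z)) (proj₁ (x∼y z))) ,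
      subst₂ θ (sym (proj₂ ⊙-distrib-∧ z u x)) (sym (proj₂ ⊙-distrib-∧ z v y))
        (∧-cong (proj₂ (u∼v z)) (proj₂ (x∼y z)))

    star-isMVMCongruence : (∀ c {u v} → θ* u v → θ* (u ⊕ c) (v ⊕ c)) →
                           (∀ c {u v} → θ* u v → θ* (u ⊙ c) (v ⊙ c)) →
                           IsMVMCongruence M θ*
    star-isMVMCongruence ⊕-right ⊙-right = record
      { isEquivalence = star-isEquivalence
      ; ⊕-cong = congruent-from-right _⊕_ ⊕-comm ⊕-right
      ; ⊙-cong = congruent-from-right _⊙_ ⊙-comm ⊙-right
      ; ∨-cong = star-∨-cong
      ; ∧-cong = star-∧-cong
      }

module StarOfKernel {a ℓ} (M : MVMonoidalAlgebra a) (θ : Rel (MVMonoidalAlgebra.Carrier M) ℓ)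
  {h : MVMonoidalAlgebra.Carrier M → Bool} (ker : IsKernelOfLatticeHomToBool M θ h) where
  open MVMonoidalAlgebra M
  open IsKernelOfLatticeHomToBool ker
  open LatticeHomToBool M h ∨-homo ∧-homo using (h-[a⊕c]⊙x)
  open StarRelation M θ using (θ*; star⇒θ)
  open IsCommutativeMonoid ⊕-isCommutativeMonoid using () renaming (assoc to ⊕-assoc)

  star-⊕-congʳ : ∀ c {u v} → θ* u v → θ* (u ⊕ c) (v ⊕ c)
  star-⊕-congʳ c {u} {v} u∼v x =
    subst₂ θ (sym (⊕-assoc u c x)) (sym (⊕-assoc v c x)) (proj₁ (u∼v (c ⊕ x))) ,
    ≡⇒θ h-cong
    where
    h-cong : h ((u ⊕ c) ⊙ x) ≡ h ((v ⊕ c) ⊙ x)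
    h-cong rewrite h-[a⊕c]⊙x u c x | h-[a⊕c]⊙x v c x
                 | θ⇒≡ (star⇒θ u∼v) | θ⇒≡ (proj₂ (u∼v (c ⊕ x))) | θ⇒≡ (proj₁ (u∼v (c ⊙ x))) = refl

module _ {a ℓ} (M : MVMonoidalAlgebra a) (θ : Rel (MVMonoidalAlgebra.Carrier M) ℓ)
  {h : MVMonoidalAlgebra.Carrier M → Bool} (ker : IsKernelOfLatticeHomToBool M θ h) where
  open MVMonoidalAlgebra M

  star-⊙-congʳ : ∀ c {u v} → star M θ u v → star M θ (u ⊙ c) (v ⊙ c)
  star-⊙-congʳ c u∼v =
    ×-swap ∘ StarOfKernel.star-⊕-congʳ (dual M) θ (dual-isKernel ker) c (×-swap ∘ u∼v)

module TwoClassQuotient {a ℓ} (M : MVMonoidalAlgebra a) (θ : Rel (MVMonoidalAlgebra.Carrier M) ℓ)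
  (θ-cong : IsLatticeCongruence M θ) (b t : MVMonoidalAlgebra.Carrier M) (b≁t : ¬ θ b t)
  (b∧t∼b : θ (MVMonoidalAlgebra._∧_ M b t) b) (classes : ∀ x → θ x b ⊎ θ x t) where
  open MVMonoidalAlgebra M
  open IsDistributiveLattice isDistributiveLattice using (∨-comm; ∧-comm; ∨-absorbs-∧)
  open DistributiveLatticeProperties (distributiveLattice M) using (∨-idem; ∧-idem)
  open IsLatticeCongruence θ-cong
  open IsEquivalence isEquivalence
    using (reflexive) renaming (sym to θ-sym; trans to θ-trans)

  h : Carrier → Bool
  h x with classes x
  ... | inj₁ _ = false
  ... | inj₂ _ = true

  rep : Bool → Carrier
  rep false = b
  rep true = t

  θ-rep : ∀ x → θ x (rep (h x))
  θ-rep x with classes x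
  ... | inj₁ x∼b = x∼b
  ... | inj₂ x∼t = x∼t

  rep-injective : ∀ {p q} → θ (rep p) (rep q) → p ≡ q
  rep-injective {false} {false} _ = refl
  rep-injective {false} {true} b∼t = ⊥-elim (b≁t b∼t)
  rep-injective {true} {false} t∼b = ⊥-elim (b≁t (θ-sym t∼b))
  rep-injective {true} {true} _ = refl

  θ⇒≡ : θ ⇒ (_≡_ on h)
  θ⇒≡ {x} {y} x∼y = rep-injective (θ-trans (θ-sym (θ-rep x)) (θ-trans x∼y (θ-rep y)))

  ≡⇒θ : (_≡_ on h) ⇒ θ
  ≡⇒θ {x} {y} hx≡hy = θ-trans (subst (θ x ∘ rep) hx≡hy (θ-rep x)) (θ-sym (θ-rep y))

  h-rep : ∀ p → h (rep p) ≡ p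
  h-rep p = sym (rep-injective (θ-rep (rep p)))

  b∨t∼t : θ (b ∨ t) t
  b∨t∼t = θ-trans (∨-cong (θ-sym b∧t∼b) (reflexive refl))
            (reflexive (trans (∨-comm (b ∧ t) t) (trans (cong (t ∨_) (∧-comm b t)) (∨-absorbs-∧ t b))))

  rep-∧ : ∀ p q → θ (rep p ∧ rep q) (rep (p ∧ᵇ q))
  rep-∧ false false = reflexive (∧-idem b)
  rep-∧ false true = b∧t∼b
  rep-∧ true false = θ-trans (reflexive (∧-comm t b)) b∧t∼b
  rep-∧ true true = reflexive (∧-idem t)

  rep-∨ : ∀ p q → θ (rep p ∨ rep q) (rep (p ∨ᵇ q))
  rep-∨ false false = reflexive (∨-idem b)
  rep-∨ false true = b∨t∼t
  rep-∨ true false = θ-trans (reflexive (∨-comm t b)) b∨t∼t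
  rep-∨ true true = reflexive (∨-idem t)

  isKernel : IsKernelOfLatticeHomToBool M θ h
  isKernel = record
    { ∨-homo = λ x y → trans (θ⇒≡ (θ-trans (∨-cong (θ-rep x) (θ-rep y)) (rep-∨ (h x) (h y)))) (h-rep _)
    ; ∧-homo = λ x y → trans (θ⇒≡ (θ-trans (∧-cong (θ-rep x) (θ-rep y)) (rep-∧ (h x) (h y)))) (h-rep _)
    ; θ⇒≡ = θ⇒≡
    ; ≡⇒θ = ≡⇒θ
    }

kernelOfTwoClasses : ∀ {a ℓ} (M : MVMonoidalAlgebra a) (θ : Rel (MVMonoidalAlgebra.Carrier M) ℓ) →
                     IsLatticeCongruence M θ → HasExactlyTwoClasses M θ →
                     Σ (MVMonoidalAlgebra.Carrier M → Bool) (IsKernelOfLatticeHomToBool M θ)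
kernelOfTwoClasses M θ θ-cong (p , q , p≁q , classes) = order (classes (p ∧ q))
  where
  open MVMonoidalAlgebra M
  open IsDistributiveLattice isDistributiveLattice using (∧-comm)
  open IsEquivalence (IsLatticeCongruence.isEquivalence θ-cong)
    using (reflexive) renaming (sym to θ-sym; trans to θ-trans)
  order : θ (p ∧ q) p ⊎ θ (p ∧ q) q → Σ (Carrier → Bool) (IsKernelOfLatticeHomToBool M θ)
  order (inj₁ p∧q∼p) = _ , TwoClassQuotient.isKernel M θ θ-cong p q p≁q p∧q∼p classes
  order (inj₂ p∧q∼q) = _ , TwoClassQuotient.isKernel M θ θ-cong q p (p≁q ∘ θ-sym)
    (θ-trans (reflexive (∧-comm q p)) p∧q∼q) (⊎-swap ∘ classes)

lemmaB1 : ∀ {a ℓ ℓ' : Level} (M : MVMonoidalAlgebra a)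
            (θ : Rel (MVMonoidalAlgebra.Carrier M) ℓ) →
            IsLatticeCongruence M θ → HasExactlyTwoClasses M θ →
            IsGreatestMVMCongruenceIn M ℓ' (star M θ) θ
lemmaB1 M θ θ-cong two-classes with kernelOfTwoClasses M θ θ-cong two-classes
... | _ , ker =
  star-isMVMCongruence θ-cong (StarOfKernel.star-⊕-congʳ M θ ker) (star-⊙-congʳ M θ ker) ,
  star⇒θ ,
  ⇒star
  where open StarRelation M θ
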